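{- Let $n\ge 3$ and let $(C_n,L)$ be an edge-labeled $n$-cycle with positive integer edge labels $\ell_1,\dots,\ell_n$. If $(0,g_2,\dots,g_n)$ is a generalized spline on $(C_n,L)$, then $g_2$ is a multiple of $\operatorname{lcm}(\ell_1,\gcd(\ell_2,\dots,\ell_n))$. Moreover, there exists a generalized spline $(0,g_2,\dots,g_n)$ on $(C_n,L)$ with $g_2=\operatorname{lcm}(\ell_1,\gcd(\ell_2,\dots,\ell_n))$, so this is the smallest positive value of the leading entry of a flow-up class $\mathcal{G}_1$.
   Context: An edge-labeled $n$-cycle $(C_n,L)$: vertices $v_1,\dots,v_n$; edge $e_i$ joins $v_i$ and $v_{i+1}$ for $1\le i\le n-1$, and $e_n$ joins $v_n$ and $v_1$; edge $e_i$ carries label $\ell_i$. A generalized spline on $(C_n,L)$ is a tuple $(g_1,\dots,g_n)\in\mathbb{Z}^n$ with $g_i\equiv g_{i+1}\pmod{\ell_i}$ for $1\le i\le n-1$ and $g_n\equiv g_1\pmod{\ell_n}$. A flow-up class $\mathcal{G}_1$ is a spline $(0,g_2,\dots,g_n)$ with $g_2\neq0$. -}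

module Defs where

open import Data.Nat using (ℕ; zero; suc)
open import Data.Nat.GCD using (gcd)
open import Data.Fin using (Fin; zero; suc; inject₁; fromℕ)
open import Data.Integer using (ℤ; _-_; +_)
open import Data.Integer.Divisibility using (_∣_)
open import Data.Product using (_×_)

-- Edge-labeled n-cycle with n = suc k vertices v₁ … vₙ, represented by Fin (suc k)
-- (vertex vᵢ ↦ index i-1).  Labels ℓ : Fin (suc k) → ℕ, where ℓ j is the label of
-- edge e_{j+1}.  For j : Fin k, edge e_{j+1} joins vertex (inject₁ j) and (suc j);
-- the closing edge eₙ (label ℓ (fromℕ k)) joins vertex vₙ = fromℕ k and v₁ = zero.

IsSpline : (k : ℕ) → (Fin (suc k) → ℕ) → (Fin (suc k) → ℤ) → Set
IsSpline k ℓ g =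
  ((j : Fin k) → (+ ℓ (inject₁ j)) ∣ (g (inject₁ j) - g (suc j)))
  × ((+ ℓ (fromℕ k)) ∣ (g (fromℕ k) - g zero))

-- gcd of all values of f : Fin m → ℕ (gcd 0 x = x, so the base case is neutral).
gcdAll : (m : ℕ) → (Fin m → ℕ) → ℕ
gcdAll zero    f = 0
gcdAll (suc m) f = gcd (f zero) (gcdAll m (λ j → f (suc j)))

-- Removing the edge e₁ leaves the path v₂ — ⋯ — vₙ — v₁ with labels ℓ₂, …, ℓₙ.  Along it g₂ − g₁
-- telescopes into a sum of multiples of the labels, so gcd(ℓ₂, …, ℓₙ) divides it; conversely, by
-- Bézout, every multiple of that gcd splits edge by edge into a spline on the path.  Adding the
-- condition ℓ₁ ∣ g₁ − g₂ of the edge e₁, the possible values of g₂ − g₁ are exactly the multiples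
-- of lcm(ℓ₁, gcd(ℓ₂, …, ℓₙ)).
module Submission where

open import Defs
open import Data.Nat using (ℕ; zero; suc; _>_)
import Data.Nat as ℕ
open import Data.Nat.GCD using (gcd; gcd-GCD; gcd[m,n]∣m; gcd[m,n]∣n; gcd-identityʳ)
import Data.Nat.GCD as ℕ
open import Data.Nat.LCM using (lcm)
open import Data.Fin using (Fin; zero; suc; inject₁; fromℕ)
open import Data.Integer using (ℤ; +_; 0ℤ; _+_; _*_; _-_; -_)
open import Data.Integer.Properties using (pos-+; pos-*; +-comm; +-identityʳ)
open import Data.Integer.Divisibility using (_∣_)
open import Data.Integer.Divisibility.Signed
  using (divides; ∣ᵤ⇒∣; ∣⇒∣ᵤ; ∣-refl; ∣-reflexive; ∣-trans; ∣m∣n⇒∣m+n; ∣m⇒∣-m)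
  renaming (_∣_ to _∣ₛ_)
import Data.Integer.LCM as ℤ
open import Data.Integer.Tactic.RingSolver using (solve-∀)
open import Data.Product using (_×_; Σ; ∃₂; _,_)
open import Data.Vec.Functional using (_∷_)
open import Function using (_∘_)
open import Relation.Binary.PropositionalEquality
  using (_≡_; refl; sym; trans; cong; subst; module ≡-Reasoning)

open ≡-Reasoning

∣-sym-difference : ∀ {k} a b → k ∣ₛ a - b → k ∣ₛ b - a
∣-sym-difference {k} a b k∣a-b = subst (k ∣ₛ_) (negate-difference a b) (∣m⇒∣-m k∣a-b)
  where
  negate-difference : ∀ a b → - (a - b) ≡ b - a
  negate-difference = solve-∀

pos-affine : ∀ d a b c e → d ℕ.+ a ℕ.* b ≡ c ℕ.* e → + d + + a * + b ≡ + c * + e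
pos-affine d a b c e eq = begin
  + d + + a * + b     ≡⟨ cong (_+_ (+ d)) (sym (pos-* a b)) ⟩
  + d + + (a ℕ.* b)   ≡⟨ sym (pos-+ d (a ℕ.* b)) ⟩
  + (d ℕ.+ a ℕ.* b)   ≡⟨ cong +_ eq ⟩
  + (c ℕ.* e)         ≡⟨ pos-* c e ⟩
  + c * + e           ∎

isolate : ∀ d a b {t} → d + a * b ≡ t → d ≡ t + - a * b
isolate d a b eq = trans (add-subtract d a b) (cong (_+ - a * b) eq)
  where
  add-subtract : ∀ d a b → d ≡ (d + a * b) + - a * b
  add-subtract = solve-∀

bézout : ∀ m n → ∃₂ λ a b → + gcd m n ≡ a * + m + b * + n
bézout m n with ℕ.Bézout.identity (gcd-GCD m n)
... | ℕ.Bézout.+- x y eq = + x , - + y , isolate (+ gcd m n) (+ y) (+ n) (pos-affine _ y n x m eq)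
... | ℕ.Bézout.-+ x y eq = - + x , + y ,
  trans (isolate (+ gcd m n) (+ x) (+ m) (pos-affine _ x m y n eq)) (+-comm (+ y * + n) (- + x * + m))

gcd∣⇒sum-of-multiples : ∀ {m n x} → + gcd m n ∣ₛ x → Σ ℤ λ y → + m ∣ₛ x - y × + n ∣ₛ y
gcd∣⇒sum-of-multiples {m} {n} {x} (divides c x≡c*d) with bézout m n
... | a , b , d≡am+bn = c * b * + n , divides (c * a) x-y≡ca*m , divides (c * b) refl
  where
  distribute : ∀ c a b m n → c * (a * m + b * n) - c * b * n ≡ c * a * m
  distribute = solve-∀
  x-y≡ca*m : x - c * b * + n ≡ c * a * + m
  x-y≡ca*m = begin
    x - c * b * + n                         ≡⟨ cong (_- c * b * + n) x≡c*d ⟩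
    c * + gcd m n - c * b * + n             ≡⟨ cong (λ d → c * d - c * b * + n) d≡am+bn ⟩
    c * (a * + m + b * + n) - c * b * + n   ≡⟨ distribute c a b (+ m) (+ n) ⟩
    c * a * + m                             ∎

gcd∣ˡ : ∀ m n → + gcd m n ∣ₛ + m
gcd∣ˡ m n = ∣ᵤ⇒∣ (gcd[m,n]∣m m n)

gcd∣ʳ : ∀ m n → + gcd m n ∣ₛ + n
gcd∣ʳ m n = ∣ᵤ⇒∣ (gcd[m,n]∣n m n)

-- A spline on the path v₀ — ⋯ — v_k — w whose extra end vertex w carries the fixed value e;
-- the last label ℓ (fromℕ k) is that of the edge v_k — w.
IsPathSpline : (k : ℕ) → (Fin (suc k) → ℕ) → (Fin (suc k) → ℤ) → ℤ → Set
IsPathSpline k ℓ p e =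
  ((j : Fin k) → + ℓ (inject₁ j) ∣ p (inject₁ j) - p (suc j)) × (+ ℓ (fromℕ k) ∣ p (fromℕ k) - e)

gcdAll∣pathSpline-ends : ∀ k ℓ p e → IsPathSpline k ℓ p e → + gcdAll (suc k) ℓ ∣ₛ p zero - e
gcdAll∣pathSpline-ends zero ℓ p e (_ , last) = ∣-trans (gcd∣ˡ (ℓ zero) 0) (∣ᵤ⇒∣ {_} {p zero - e} last)
gcdAll∣pathSpline-ends (suc k) ℓ p e (edges , last) =
  subst (_ ∣ₛ_) (telescope (p zero) (p (suc zero)) e)
    (∣m∣n⇒∣m+n (∣-trans (gcd∣ˡ (ℓ zero) _) (∣ᵤ⇒∣ {_} {p zero - p (suc zero)} (edges zero)))
               (∣-trans (gcd∣ʳ (ℓ zero) _) rest))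
  where
  telescope : ∀ a b c → (a - b) + (b - c) ≡ a - c
  telescope = solve-∀
  rest : + gcdAll (suc k) (ℓ ∘ suc) ∣ₛ p (suc zero) - e
  rest = gcdAll∣pathSpline-ends k (ℓ ∘ suc) (p ∘ suc) e ((λ j → edges (suc j)) , last)

gcdAll∣⇒pathSpline : ∀ k ℓ {x e} → + gcdAll (suc k) ℓ ∣ₛ x - e →
                  Σ (Fin (suc k) → ℤ) λ p → IsPathSpline k ℓ p e × p zero ≡ x
gcdAll∣⇒pathSpline zero ℓ {x} d =
  (λ _ → x) , ((λ ()) , ∣⇒∣ᵤ (∣-trans (∣-reflexive (cong +_ (sym (gcd-identityʳ (ℓ zero))))) d)) , refl
gcdAll∣⇒pathSpline (suc k) ℓ {x} {e} d = extend (gcd∣⇒sum-of-multiples d)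
  where
  add-subtract : ∀ y e → y ≡ (y + e) - e
  add-subtract = solve-∀
  regroup : ∀ x e y → (x - e) - y ≡ x - (y + e)
  regroup = solve-∀
  extend : Σ ℤ (λ y → + ℓ zero ∣ₛ x - e - y × + gcdAll (suc k) (ℓ ∘ suc) ∣ₛ y) →
           Σ (Fin (suc (suc k)) → ℤ) λ p → IsPathSpline (suc k) ℓ p e × p zero ≡ x
  extend (y , ℓ₀∣x-e-y , G∣y) =
    let p , (edges , last) , p₀≡y+e =
          gcdAll∣⇒pathSpline k (ℓ ∘ suc) (subst (_ ∣ₛ_) (add-subtract y e) G∣y)
        first = ∣⇒∣ᵤ (subst (_ ∣ₛ_) (trans (regroup x e y) (cong (_-_ x) (sym p₀≡y+e))) ℓ₀∣x-e-y)
    in x ∷ p , ((λ { zero → first ; (suc j) → edges j }) , last) , refl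

lcm∣spline-difference : ∀ k ℓ g → IsSpline (suc k) ℓ g →
                        + lcm (ℓ zero) (gcdAll (suc k) (ℓ ∘ suc)) ∣ g (suc zero) - g zero
lcm∣spline-difference k ℓ g (edges , last) =
  ℤ.lcm-least {+ ℓ zero} {+ G} {g (suc zero) - g zero} (∣⇒∣ᵤ ℓ₀∣g₁-g₀) (∣⇒∣ᵤ G∣g₁-g₀)
  where
  G = gcdAll (suc k) (ℓ ∘ suc)
  ℓ₀∣g₁-g₀ : + ℓ zero ∣ₛ g (suc zero) - g zero
  ℓ₀∣g₁-g₀ = ∣-sym-difference (g zero) (g (suc zero)) (∣ᵤ⇒∣ (edges zero))
  G∣g₁-g₀ : + G ∣ₛ g (suc zero) - g zero
  G∣g₁-g₀ = gcdAll∣pathSpline-ends k (ℓ ∘ suc) (g ∘ suc) (g zero) ((λ j → edges (suc j)) , last)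

lcm∣⇒spline : ∀ k ℓ {x e} → + lcm (ℓ zero) (gcdAll (suc k) (ℓ ∘ suc)) ∣ₛ x - e →
  Σ (Fin (suc (suc k)) → ℤ) λ g → IsSpline (suc k) ℓ g × g zero ≡ e × g (suc zero) ≡ x
lcm∣⇒spline k ℓ {x} {e} L∣x-e =
  let p , (edges , last) , p₀≡x = gcdAll∣⇒pathSpline k (ℓ ∘ suc) (∣-trans G∣L L∣x-e)
      first = ∣⇒∣ᵤ (subst (λ z → + ℓ zero ∣ₛ e - z) (sym p₀≡x) (∣-sym-difference x e (∣-trans ℓ₀∣L L∣x-e)))
  in e ∷ p , ((λ { zero → first ; (suc j) → edges j }) , last) , refl , p₀≡x
  where
  G = gcdAll (suc k) (ℓ ∘ suc)
  ℓ₀∣L : + ℓ zero ∣ₛ + lcm (ℓ zero) G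
  ℓ₀∣L = ∣ᵤ⇒∣ (ℤ.i∣lcm[i,j] (+ ℓ zero) (+ G))
  G∣L : + G ∣ₛ + lcm (ℓ zero) G
  G∣L = ∣ᵤ⇒∣ (ℤ.j∣lcm[i,j] (+ ℓ zero) (+ G))

theorem4p4 : (m : ℕ) → (ℓ : Fin (suc (suc (suc m))) → ℕ) → ((i : Fin (suc (suc (suc m)))) → ℓ i > 0) →
    (((g : Fin (suc (suc (suc m))) → ℤ) → IsSpline (suc (suc m)) ℓ g → g zero ≡ 0ℤ →
        (+ lcm (ℓ zero) (gcdAll (suc (suc m)) (λ j → ℓ (suc j)))) ∣ g (suc zero))
    × Σ (Fin (suc (suc (suc m))) → ℤ) (λ g → IsSpline (suc (suc m)) ℓ g × g zero ≡ 0ℤ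
        × g (suc zero) ≡ + lcm (ℓ zero) (gcdAll (suc (suc m)) (λ j → ℓ (suc j)))))
theorem4p4 m ℓ _ = leading-entry-divisible , lcm∣⇒spline (suc m) ℓ L∣L-0
  where
  L = lcm (ℓ zero) (gcdAll (suc (suc m)) (ℓ ∘ suc))
  leading-entry-divisible : ∀ g → IsSpline (suc (suc m)) ℓ g → g zero ≡ 0ℤ → + L ∣ g (suc zero)
  leading-entry-divisible g spline g₀≡0 =
    subst (+ L ∣_) (trans (cong (_-_ (g (suc zero))) g₀≡0) (+-identityʳ (g (suc zero))))
      (lcm∣spline-difference (suc m) ℓ g spline)
  L∣L-0 : + L ∣ₛ + L - 0ℤ
  L∣L-0 = subst (+ L ∣ₛ_) (sym (+-identityʳ (+ L))) ∣-refl
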